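{- For all integers $n,\ell$ with $\ell\ge2$ and $n\ge 1+2\ell\log_2 n$ we have $\left\{ {n \atop \ell} \right\}\ge n^2\left\{ {n-1 \atop \ell-1} \right\}$.
   Context: $\left\{ {m \atop j} \right\}$ denotes the Stirling number of the second kind: the number of partitions of an $m$-element set into exactly $j$ nonempty parts. -}

module Defs where

open import Data.Nat using (ℕ; zero; suc; _+_; _*_)

S : ℕ → ℕ → ℕ
S zero    zero    = 1
S zero    (suc k) = 0
S (suc n) zero    = 0
S (suc n) (suc k) = suc k * S n (suc k) + S n k

{-# OPTIONS --safe #-}
module Submission where

-- Grouping the maps from an m-set to an x-set by their image gives
-- x ^ m = ∑_{j ≤ x} S(m,j) · x(x-1)⋯(x-j+1).  Hence the S(m,x) · x! surjections number at
-- most x ^ m, and all but at most (y+1) · y ^ m of the (y+1) ^ m maps onto a (y+1)-set are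
-- surjective.  Writing ℓ = k+1 and n = m+1, multiplying the claim by ℓ! and using these two
-- bounds reduces it to (n² + k) · k ^ m ≤ (k+1) ^ m.  Raised to the k-th power, this follows
-- from (n² + k) ^ k ≤ n ^ (2k+2) (as k < n), the hypothesis n ^ (2k+2) ≤ 2 ^ m, and
-- 2 · k ^ k ≤ (k+1) ^ k.

open import Defs
open import Data.Nat.Base
open import Data.Nat.Properties
open import Data.Nat.Combinatorics.Base using (_P′_)
open import Data.Nat.Combinatorics.Specification using (nP′n≡n!; nP′k≡n[n∸1P′k∸1])
open import Data.Nat.Tactic.RingSolver using (solve-∀)
open import Data.Fin.Base using (toℕ)
open import Data.Fin.Properties using (toℕ<n; toℕ-inject₁; toℕ-fromℕ)
open import Algebra.Properties.Semiring.Sum +-*-semiring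
  using (sum; sum-cong-≗; ∑-distrib-+; *-distribˡ-sum; sum-init-last; sum-replicate-zero)
open import Function.Base using (_∘_)
open import Relation.Binary.PropositionalEquality
open import Relation.Nullary.Negation using (contradiction)
open import Relation.Nullary.Decidable.Core using (yes; no)
open import Algebra.Properties.CommutativeSemigroup *-commutativeSemigroup using (x∙yz≈y∙xz; xy∙z≈y∙xz; interchange)

∑< : ℕ → (ℕ → ℕ) → ℕ
∑< N f = sum {N} (f ∘ toℕ)

∑<-cong : ∀ N {f g : ℕ → ℕ} → (∀ j → j < N → f j ≡ g j) → ∑< N f ≡ ∑< N g
∑<-cong N f≡g = sum-cong-≗ {N} (λ i → f≡g (toℕ i) (toℕ<n i))

∑<-distrib-+ : ∀ N (f g : ℕ → ℕ) → ∑< N (λ j → f j + g j) ≡ ∑< N f + ∑< N g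
∑<-distrib-+ N f g = ∑-distrib-+ {N} (f ∘ toℕ) (g ∘ toℕ)

*-distribˡ-∑< : ∀ N x (f : ℕ → ℕ) → x * ∑< N f ≡ ∑< N (λ j → x * f j)
*-distribˡ-∑< N x f = *-distribˡ-sum {N} x (f ∘ toℕ)

∑<-mono : ∀ N {f g : ℕ → ℕ} → (∀ j → j < N → f j ≤ g j) → ∑< N f ≤ ∑< N g
∑<-mono zero    f≤g = z≤n
∑<-mono (suc N) f≤g = +-mono-≤ (f≤g 0 z<s) (∑<-mono N (λ j j<N → f≤g (suc j) (s<s j<N)))

∑<-last : ∀ N (f : ℕ → ℕ) → ∑< (suc N) f ≡ ∑< N f + f N
∑<-last N f = trans (sum-init-last {N} (f ∘ toℕ))
  (cong₂ _+_ (sum-cong-≗ {N} (cong f ∘ toℕ-inject₁)) (cong f (toℕ-fromℕ N)))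

n*nP′k≡nP′[1+k]+k*nP′k : ∀ {n k} → k ≤ n → n * (n P′ k) ≡ n P′ suc k + k * (n P′ k)
n*nP′k≡nP′[1+k]+k*nP′k {n} {k} k≤n = begin
  n * (n P′ k)              ≡⟨ cong (_* (n P′ k)) (m∸n+n≡m k≤n) ⟨
  (n ∸ k + k) * (n P′ k)    ≡⟨ *-distribʳ-+ (n P′ k) (n ∸ k) k ⟩
  n P′ suc k + k * (n P′ k) ∎
  where open ≡-Reasoning

[1+n]P′k≤[1+n]*nP′k : ∀ {n k} → k ≤ n → suc n P′ k ≤ suc n * (n P′ k)
[1+n]P′k≤[1+n]*nP′k {n} {k} k≤n = begin
  suc n P′ k       ≤⟨ m≤n*m (suc n P′ k) (suc n ∸ k) {{>-nonZero (m<n⇒0<n∸m (s≤s k≤n))}} ⟩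
  suc n P′ suc k   ≡⟨ nP′k≡n[n∸1P′k∸1] (suc n) (suc k) ⟩
  suc n * (n P′ k) ∎
  where open ≤-Reasoning

x^m≡∑S[m,j]*xP′j : ∀ x m → x ^ m ≡ ∑< (suc x) (λ j → S m j * (x P′ j))
x^m≡∑S[m,j]*xP′j x zero    = cong suc (sym (sum-replicate-zero x))
x^m≡∑S[m,j]*xP′j x (suc m) = begin
  x * x ^ m                                      ≡⟨ cong (x *_) (x^m≡∑S[m,j]*xP′j x m) ⟩
  x * ∑< (suc x) t                               ≡⟨ *-distribˡ-∑< (suc x) x t ⟩
  ∑< (suc x) (λ j → x * t j)                     ≡⟨ ∑<-cong (suc x) (λ j j<1+x → x*t≡u+j*t j (s≤s⁻¹ j<1+x)) ⟩
  ∑< (suc x) (λ j → u j + j * t j)               ≡⟨ ∑<-distrib-+ (suc x) u (λ j → j * t j) ⟩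
  ∑< (suc x) u + ∑< x (λ j → suc j * t (suc j))  ≡⟨ cong (_+ ∑< x (λ j → suc j * t (suc j))) ∑u-drop-last ⟩
  ∑< x u + ∑< x (λ j → suc j * t (suc j))        ≡⟨ ∑<-distrib-+ x u (λ j → suc j * t (suc j)) ⟨
  ∑< x (λ j → u j + suc j * t (suc j))           ≡⟨ ∑<-cong x (λ j _ → collect (suc j) (S m (suc j)) (S m j) (x P′ suc j)) ⟩
  ∑< x (λ j → S (suc m) (suc j) * (x P′ suc j))  ∎
  where
  open ≡-Reasoning
  -- In the fourth and the last step the j = 0 summand vanishes by computation.
  t u : ℕ → ℕ
  t j = S m j * (x P′ j)
  u j = S m j * (x P′ suc j)
  x*t≡u+j*t : ∀ j → j ≤ x → x * t j ≡ u j + j * t j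
  x*t≡u+j*t j j≤x = begin
    x * (S m j * (x P′ j))                         ≡⟨ x∙yz≈y∙xz x (S m j) (x P′ j) ⟩
    S m j * (x * (x P′ j))                         ≡⟨ cong (S m j *_) (n*nP′k≡nP′[1+k]+k*nP′k j≤x) ⟩
    S m j * (x P′ suc j + j * (x P′ j))            ≡⟨ *-distribˡ-+ (S m j) (x P′ suc j) (j * (x P′ j)) ⟩
    S m j * (x P′ suc j) + S m j * (j * (x P′ j))  ≡⟨ cong (u j +_) (x∙yz≈y∙xz (S m j) j (x P′ j)) ⟩
    u j + j * t j                                  ∎
  ∑u-drop-last : ∑< (suc x) u ≡ ∑< x u
  ∑u-drop-last = begin
    ∑< (suc x) u                           ≡⟨ ∑<-last x u ⟩
    ∑< x u + S m x * ((x ∸ x) * (x P′ x))  ≡⟨ cong (λ d → ∑< x u + S m x * (d * (x P′ x))) (n∸n≡0 x) ⟩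
    ∑< x u + S m x * 0                     ≡⟨ cong (∑< x u +_) (*-zeroʳ (S m x)) ⟩
    ∑< x u + 0                             ≡⟨ +-identityʳ (∑< x u) ⟩
    ∑< x u                                 ∎
  collect : ∀ a b c p → c * p + a * (b * p) ≡ (a * b + c) * p
  collect = solve-∀

surjections : ℕ → ℕ → ℕ
surjections m x = S m x * x !

surjections≤^ : ∀ m x → surjections m x ≤ x ^ m
surjections≤^ m x = begin
  S m x * x !             ≡⟨ cong (S m x *_) (nP′n≡n! x) ⟨
  t x                     ≤⟨ m≤n+m (t x) (∑< x t) ⟩
  ∑< x t + t x            ≡⟨ ∑<-last x t ⟨
  ∑< (suc x) t            ≡⟨ x^m≡∑S[m,j]*xP′j x m ⟨
  x ^ m                   ∎
  where
  open ≤-Reasoning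
  t : ℕ → ℕ
  t j = S m j * (x P′ j)

^≤surjections+[1+y]*y^m : ∀ m y → suc y ^ m ≤ surjections m (suc y) + suc y * y ^ m
^≤surjections+[1+y]*y^m m y = begin
  suc y ^ m                                      ≡⟨ x^m≡∑S[m,j]*xP′j (suc y) m ⟩
  ∑< (suc (suc y)) t                             ≡⟨ ∑<-last (suc y) t ⟩
  ∑< (suc y) t + t (suc y)                       ≤⟨ +-monoˡ-≤ (t (suc y)) (∑<-mono (suc y) t≤[1+y]*t′) ⟩
  ∑< (suc y) (λ j → suc y * t′ j) + t (suc y)    ≡⟨ cong₂ _+_ ∑[1+y]*t′≡[1+y]*y^m (cong (S m (suc y) *_) (nP′n≡n! (suc y))) ⟩
  suc y * y ^ m + surjections m (suc y)          ≡⟨ +-comm (suc y * y ^ m) (surjections m (suc y)) ⟩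
  surjections m (suc y) + suc y * y ^ m          ∎
  where
  open ≤-Reasoning
  t t′ : ℕ → ℕ
  t  j = S m j * (suc y P′ j)
  t′ j = S m j * (y P′ j)
  t≤[1+y]*t′ : ∀ j → j < suc y → t j ≤ suc y * t′ j
  t≤[1+y]*t′ j j<1+y = begin
    S m j * (suc y P′ j)        ≤⟨ *-monoʳ-≤ (S m j) ([1+n]P′k≤[1+n]*nP′k (s≤s⁻¹ j<1+y)) ⟩
    S m j * (suc y * (y P′ j))  ≡⟨ x∙yz≈y∙xz (S m j) (suc y) (y P′ j) ⟩
    suc y * t′ j                ∎
  ∑[1+y]*t′≡[1+y]*y^m : ∑< (suc y) (λ j → suc y * t′ j) ≡ suc y * y ^ m
  ∑[1+y]*t′≡[1+y]*y^m = sym (trans (cong (suc y *_) (x^m≡∑S[m,j]*xP′j y m)) (*-distribˡ-∑< (suc y) (suc y) t′))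

[1+k]*c*k^m≤surjections : ∀ c k m → (c + k) * k ^ m ≤ suc k ^ m →
                          suc k * (c * k ^ m) ≤ surjections (suc m) (suc k)
[1+k]*c*k^m≤surjections c k m [c+k]k^m≤[1+k]^m = +-cancelʳ-≤ (suc k * k ^ suc m) _ _ (begin
  suc k * (c * k ^ m) + suc k * k ^ suc m   ≡⟨ distrib (suc k) c k (k ^ m) ⟩
  suc k * ((c + k) * k ^ m)                 ≤⟨ *-monoʳ-≤ (suc k) [c+k]k^m≤[1+k]^m ⟩
  suc k ^ suc m                             ≤⟨ ^≤surjections+[1+y]*y^m (suc m) k ⟩
  surjections (suc m) (suc k) + suc k * k ^ suc m ∎)
  where
  open ≤-Reasoning
  distrib : ∀ a c k p → a * (c * p) + a * (k * p) ≡ a * ((c + k) * p)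
  distrib = solve-∀

^-distribʳ-* : ∀ m n o → (m * n) ^ o ≡ m ^ o * n ^ o
^-distribʳ-* m n zero    = refl
^-distribʳ-* m n (suc o) = trans (cong (m * n *_) (^-distribʳ-* m n o)) (interchange m n (m ^ o) (n ^ o))

[m^n]^o≡[m^o]^n : ∀ m n o → (m ^ n) ^ o ≡ (m ^ o) ^ n
[m^n]^o≡[m^o]^n m n o = begin
  (m ^ n) ^ o   ≡⟨ ^-*-assoc m n o ⟩
  m ^ (n * o)   ≡⟨ cong (m ^_) (*-comm n o) ⟩
  m ^ (o * n)   ≡⟨ ^-*-assoc m o n ⟨
  (m ^ o) ^ n   ∎
  where open ≡-Reasoning

^-cancelˡ-≤ : ∀ n .{{_ : NonZero n}} {x y} → x ^ n ≤ y ^ n → x ≤ y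
^-cancelˡ-≤ n {x} {y} xⁿ≤yⁿ with x ≤? y
... | yes x≤y = x≤y
... | no  x≰y = contradiction xⁿ≤yⁿ (<⇒≱ (^-monoˡ-< n (≰⇒> x≰y)))

^-cancelʳ-≤ : ∀ a → 1 < a → ∀ {m n} → a ^ m ≤ a ^ n → m ≤ n
^-cancelʳ-≤ a 1<a {m} {n} aᵐ≤aⁿ with m ≤? n
... | yes m≤n = m≤n
... | no  m≰n = contradiction aᵐ≤aⁿ (<⇒≱ (^-monoʳ-< a 1<a (≰⇒> m≰n)))

a^j*[a+j]≤a*[1+a]^j : ∀ a j → a ^ j * (a + j) ≤ a * suc a ^ j
a^j*[a+j]≤a*[1+a]^j a zero    = ≤-reflexive (unit a)
  where
  unit : ∀ a → 1 * (a + 0) ≡ a * 1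
  unit = solve-∀
a^j*[a+j]≤a*[1+a]^j a (suc j) = begin
  a * a ^ j * (a + suc j)          ≡⟨ expand a (a ^ j) j ⟩
  a ^ j * (a * (a + j) + a)        ≤⟨ *-monoʳ-≤ (a ^ j) (+-monoʳ-≤ (a * (a + j)) (m≤m+n a j)) ⟩
  a ^ j * (a * (a + j) + (a + j))  ≡⟨ factor a (a ^ j) j ⟩
  suc a * (a ^ j * (a + j))        ≤⟨ *-monoʳ-≤ (suc a) (a^j*[a+j]≤a*[1+a]^j a j) ⟩
  suc a * (a * suc a ^ j)          ≡⟨ x∙yz≈y∙xz (suc a) a (suc a ^ j) ⟩
  a * (suc a * suc a ^ j)          ∎
  where
  open ≤-Reasoning
  expand : ∀ a p j → a * p * (a + suc j) ≡ p * (a * (a + j) + a)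
  expand = solve-∀
  factor : ∀ a p j → p * (a * (a + j) + (a + j)) ≡ suc a * (p * (a + j))
  factor = solve-∀

2*n^n≤[1+n]^n : ∀ n .{{_ : NonZero n}} → 2 * n ^ n ≤ suc n ^ n
2*n^n≤[1+n]^n n = *-cancelˡ-≤ n (begin
  n * (2 * n ^ n)   ≡⟨ rearrange n (n ^ n) ⟩
  n ^ n * (n + n)   ≤⟨ a^j*[a+j]≤a*[1+a]^j n n ⟩
  n * suc n ^ n     ∎)
  where
  open ≤-Reasoning
  rearrange : ∀ a p → a * (2 * p) ≡ p * (a + a)
  rearrange = solve-∀

[a+b]^j*c≤a^[1+j] : ∀ j {a b c} → c + j * b ≡ a → (a + b) ^ j * c ≤ a ^ suc j
[a+b]^j*c≤a^[1+j] zero    {a} {b} {c} c+0≡a = begin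
  1 * c    ≡⟨ *-identityˡ c ⟩
  c        ≤⟨ m≤m+n c 0 ⟩
  c + 0    ≡⟨ c+0≡a ⟩
  a        ≡⟨ *-identityʳ a ⟨
  a * 1    ∎
  where open ≤-Reasoning
[a+b]^j*c≤a^[1+j] (suc j) {a} {b} {c} c+[1+j]b≡a = begin
  (a + b) * (a + b) ^ j * c    ≡⟨ xy∙z≈y∙xz (a + b) ((a + b) ^ j) c ⟩
  (a + b) ^ j * ((a + b) * c)  ≤⟨ *-monoʳ-≤ ((a + b) ^ j) [a+b]c≤a[c+b] ⟩
  (a + b) ^ j * (a * (c + b))  ≡⟨ x∙yz≈y∙xz ((a + b) ^ j) a (c + b) ⟩
  a * ((a + b) ^ j * (c + b))  ≤⟨ *-monoʳ-≤ a ([a+b]^j*c≤a^[1+j] j (trans (shift c b j) c+[1+j]b≡a)) ⟩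
  a * a ^ suc j                ∎
  where
  open ≤-Reasoning
  shift : ∀ c b j → c + b + j * b ≡ c + suc j * b
  shift = solve-∀
  [a+b]c≤a[c+b] : (a + b) * c ≤ a * (c + b)
  [a+b]c≤a[c+b] = begin
    (a + b) * c    ≡⟨ *-distribʳ-+ c a b ⟩
    a * c + b * c  ≤⟨ +-monoʳ-≤ (a * c) (*-monoʳ-≤ b (m+n≤o⇒m≤o c (≤-reflexive c+[1+j]b≡a))) ⟩
    a * c + b * a  ≡⟨ cong (a * c +_) (*-comm b a) ⟩
    a * c + a * b  ≡⟨ *-distribˡ-+ a c b ⟨
    a * (c + b)    ∎

[N+k]^k≤N^[1+k] : ∀ {N k} → k * k < N → (N + k) ^ k ≤ N ^ suc k
[N+k]^k≤N^[1+k] {N} {k} k*k<N = begin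
  (N + k) ^ k                  ≤⟨ m≤m*n ((N + k) ^ k) (N ∸ k * k) {{>-nonZero (m<n⇒0<n∸m k*k<N)}} ⟩
  (N + k) ^ k * (N ∸ k * k)    ≤⟨ [a+b]^j*c≤a^[1+j] k (m∸n+n≡m (<⇒≤ k*k<N)) ⟩
  N ^ suc k                    ∎
  where open ≤-Reasoning

[[1+m]^2+k]*k^m≤[1+k]^m : ∀ k m .{{_ : NonZero k}} .{{_ : NonZero m}} →
                     suc m ^ (2 * suc k) ≤ 2 ^ m → (suc m ^ 2 + k) * k ^ m ≤ suc k ^ m
[[1+m]^2+k]*k^m≤[1+k]^m k m hyp = ^-cancelˡ-≤ k (begin
  ((N + k) * k ^ m) ^ k          ≡⟨ ^-distribʳ-* (N + k) (k ^ m) k ⟩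
  (N + k) ^ k * (k ^ m) ^ k      ≤⟨ *-monoˡ-≤ ((k ^ m) ^ k) ([N+k]^k≤N^[1+k] {N} {k} k*k<N) ⟩
  N ^ suc k * (k ^ m) ^ k        ≡⟨ cong (_* (k ^ m) ^ k) (^-*-assoc n 2 (suc k)) ⟩
  n ^ (2 * suc k) * (k ^ m) ^ k  ≤⟨ *-monoˡ-≤ ((k ^ m) ^ k) hyp ⟩
  2 ^ m * (k ^ m) ^ k            ≡⟨ cong (2 ^ m *_) ([m^n]^o≡[m^o]^n k m k) ⟩
  2 ^ m * (k ^ k) ^ m            ≡⟨ ^-distribʳ-* 2 (k ^ k) m ⟨
  (2 * k ^ k) ^ m                ≤⟨ ^-monoˡ-≤ m (2*n^n≤[1+n]^n k) ⟩
  (suc k ^ k) ^ m                ≡⟨ [m^n]^o≡[m^o]^n (suc k) k m ⟩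
  (suc k ^ m) ^ k                ∎)
  where
  open ≤-Reasoning
  n = suc m
  N = n ^ 2
  2[1+k]≤m : 2 * suc k ≤ m
  2[1+k]≤m = ^-cancelʳ-≤ 2 (s≤s (s≤s z≤n)) (≤-trans (^-monoˡ-≤ (2 * suc k) (s≤s (>-nonZero⁻¹ m))) hyp)
  k<n : k < n
  k<n = s≤s (≤-trans (≤-trans (n≤1+n k) (m≤m+n (suc k) (1 * suc k))) 2[1+k]≤m)
  k*k<N : k * k < N
  k*k<N = ≤-trans (*-mono-< k<n k<n) (≤-reflexive (cong (n *_) (sym (*-identityʳ n))))

lemma4 : ∀ (n ℓ : ℕ) → 2 ≤ ℓ → 1 ≤ n →
           n ^ (2 * ℓ) ≤ 2 ^ (n ∸ 1) →
           n ^ 2 * S (n ∸ 1) (ℓ ∸ 1) ≤ S n ℓ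
lemma4 _ (suc zero) (s≤s ()) _ _
lemma4 (suc zero) (suc (suc _)) _ _ _ = z≤n   -- the hypothesis is vacuous, but S 0 (ℓ ∸ 1) = 0
lemma4 n@(suc m@(suc _)) ℓ@(suc k@(suc _)) _ _ hyp = *-cancelˡ-≤ (ℓ !) {{ℓ !≢0}} (begin
  ℓ ! * (n ^ 2 * S m k)          ≡⟨ rearrange ℓ (k !) (n ^ 2) (S m k) ⟩
  ℓ * (n ^ 2 * surjections m k)  ≤⟨ *-monoʳ-≤ ℓ (*-monoʳ-≤ (n ^ 2) (surjections≤^ m k)) ⟩
  ℓ * (n ^ 2 * k ^ m)            ≤⟨ [1+k]*c*k^m≤surjections (n ^ 2) k m ([[1+m]^2+k]*k^m≤[1+k]^m k m hyp) ⟩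
  surjections n ℓ                ≡⟨ *-comm (S n ℓ) (ℓ !) ⟩
  ℓ ! * S n ℓ                    ∎)
  where
  open ≤-Reasoning
  rearrange : ∀ a f p s → a * f * (p * s) ≡ a * (p * (s * f))
  rearrange = solve-∀
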